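{- Let $p\geq 2$ be an integer and let $G$ be a graph. If $G$ is the union of a subgraph $H$ and an induced subgraph $I$ (i.e. $V(G)=V(H)\cup V(I)$ and $E(G)=E(H)\cup E(I)$, with $I$ an induced subgraph of $G$), then $\mathrm{id}^{\leq p}(G) \leq \mathrm{id}^{\leq p}(H) + \mathrm{id}^{\leq p}(I)$.
   Context: All graphs are finite and simple. In an oriented graph, the inversion of a vertex set $X$ reverses the orientation of every arc with both endvertices in $X$; a $(\leq p)$-inversion is the inversion of a set of at most $p$ vertices. For a graph $G$ with labelled vertices, $\mathrm{id}^{\leq p}(G)$ is the maximum, over all pairs of orientations $\vec G_1,\vec G_2$ of $G$, of the minimum number of $(\leq p)$-inversions transforming $\vec G_1$ into $\vec G_2$. -}

module Defs where

open import Data.Nat using (ℕ; _≤_)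
open import Data.Bool using (Bool; true; false; _∧_; _∨_; if_then_else_; not)
open import Data.Fin using (Fin)
open import Data.Fin.Subset using (Subset; _∈_; _⊆_; ∣_∣)
open import Data.Vec using (lookup)
open import Data.List using (List; []; _∷_; length; foldr)
open import Data.List.Relation.Unary.All using (All)
open import Data.Product using (_×_; Σ)
open import Relation.Binary.PropositionalEquality using (_≡_)

record Graph (n : ℕ) : Set where
  field
    V     : Subset n
    E     : Fin n → Fin n → Bool
    sym   : ∀ u v → E u v ≡ E v u
    irr   : ∀ u → E u u ≡ false
    inV   : ∀ u v → E u v ≡ true → u ∈ V
open Graph public

Arcs : ℕ → Set
Arcs n = Fin n → Fin n → Bool

IsOrientation : ∀ {n} → Graph n → Arcs n → Set
IsOrientation G A =
  (∀ u v → E G u v ≡ true → A u v ≡ not (A v u)) ×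
  (∀ u v → E G u v ≡ false → A u v ≡ false)

invert : ∀ {n} → Subset n → Arcs n → Arcs n
invert X A u v = if lookup X u ∧ lookup X v then A v u else A u v

invertAll : ∀ {n} → List (Subset n) → Arcs n → Arcs n
invertAll [] A = A
invertAll (X ∷ Xs) A = invertAll Xs (invert X A)

IsSmallInv : ∀ {n} → ℕ → Graph n → Subset n → Set
IsSmallInv p G X = (X ⊆ V G) × (∣ X ∣ ≤ p)

Transformable : ∀ {n} → ℕ → Graph n → ℕ → Arcs n → Arcs n → Set
Transformable p G k A1 A2 =
  Σ (List (Subset _)) λ Xs →
    All (IsSmallInv p G) Xs × (length Xs ≤ k) ×
    (∀ u v → invertAll Xs A1 u v ≡ A2 u v)

-- id^{≤p}(G) ≤ k : any two orientations of G are at most k (≤ p)-inversions apart.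
IdLe : ∀ {n} → ℕ → Graph n → ℕ → Set
IdLe p G k = ∀ A1 A2 → IsOrientation G A1 → IsOrientation G A2 →
  Transformable p G k A1 A2

Subgraph : ∀ {n} → Graph n → Graph n → Set
Subgraph H G = (V H ⊆ V G) × (∀ u v → E H u v ≡ true → E G u v ≡ true)

InducedSubgraph : ∀ {n} → Graph n → Graph n → Set
InducedSubgraph I G = (V I ⊆ V G) × (∀ u v → u ∈ V I → v ∈ V I → E I u v ≡ E G u v)

IsUnion : ∀ {n} → Graph n → Graph n → Graph n → Set
IsUnion G H I =
  (∀ u → u ∈ V G → lookup (V H) u ∨ lookup (V I) u ≡ true) ×
  (∀ u v → E G u v ≡ true → E H u v ∨ E I u v ≡ true)

{-# OPTIONS --safe #-}
module Submission where

-- Transform A₁ into A₂ in two stages: first at most a inversions inside V(H)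
-- that fix the arcs on E(H) (obtained from the restrictions of A₁ and A₂ to H),
-- then at most b inversions inside V(I) that fix the arcs on E(I). The second
-- stage only reverses pairs inside V(I); as I is induced, every G-edge among
-- them lies in E(I), so the arcs on E(H) ∖ E(I) keep their direction.

open import Defs
open import Data.Nat using (ℕ; _≤_; _+_)
open import Data.Nat.Properties using (+-mono-≤; ≤-reflexive; ≤-trans)
open import Data.Bool using (Bool; true; false; _∧_; _∨_; _xor_; if_then_else_; not)
open import Data.Bool.Properties using (∧-comm; ∨-identityʳ; not-involutive)
open import Data.Empty using (⊥-elim)
open import Data.Fin using (Fin)
open import Data.Fin.Subset using (Subset; _∈_; _⊆_)
open import Data.Vec using (lookup)
open import Data.Vec.Properties using (lookup⇒[]=)
open import Data.List using (List; []; _∷_; _++_)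
open import Data.List.Properties using (length-++)
open import Data.List.Relation.Unary.All as All using (All; []; _∷_)
open import Data.List.Relation.Unary.All.Properties using (++⁺)
open import Data.Product using (_×_; _,_; proj₁)
open import Relation.Nullary using (¬_)
open import Relation.Binary.PropositionalEquality
  using (_≡_; refl; trans; cong; cong₂; subst; module ≡-Reasoning)
  renaming (sym to ≡-sym)

private
  variable
    n : ℕ

parity : List (Subset n) → Fin n → Fin n → Bool
parity []       u v = false
parity (X ∷ Xs) u v = (lookup X u ∧ lookup X v) xor parity Xs u v

parity-sym : (Xs : List (Subset n)) → ∀ u v → parity Xs u v ≡ parity Xs v u
parity-sym []       u v = refl
parity-sym (X ∷ Xs) u v =
  cong₂ _xor_ (∧-comm (lookup X u) (lookup X v)) (parity-sym Xs u v)

invertAll-parity : (Xs : List (Subset n)) (A : Arcs n) → ∀ u v →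
  invertAll Xs A u v ≡ (if parity Xs u v then A v u else A u v)
invertAll-parity []       A u v = refl
invertAll-parity (X ∷ Xs) A u v
  rewrite invertAll-parity Xs (invert X A) u v
  with lookup X u | lookup X v | parity Xs u v
... | true  | true  | true  = refl
... | true  | true  | false = refl
... | true  | false | _     = refl
... | false | true  | _     = refl
... | false | false | _     = refl

invertAll-++ : (Xs Ys : List (Subset n)) (A : Arcs n) →
  invertAll (Xs ++ Ys) A ≡ invertAll Ys (invertAll Xs A)
invertAll-++ []       Ys A = refl
invertAll-++ (X ∷ Xs) Ys A = invertAll-++ Xs Ys (invert X A)

parity-outside : {S : Subset n} (Xs : List (Subset n)) → All (_⊆ S) Xs →
  ∀ {u v} → ¬ (u ∈ S × v ∈ S) → parity Xs u v ≡ false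
parity-outside []       []             uv∉S = refl
parity-outside (X ∷ Xs) (X⊆S ∷ Xs⊆S) {u} {v} uv∉S
  with lookup X u in u∈X | lookup X v in v∈X
... | true  | true  = ⊥-elim (uv∉S (X⊆S (lookup⇒[]= u X u∈X) , X⊆S (lookup⇒[]= v X v∈X)))
... | true  | false = parity-outside Xs Xs⊆S uv∉S
... | false | _     = parity-outside Xs Xs⊆S uv∉S

invertAll-outside : {S : Subset n} (Xs : List (Subset n)) → All (_⊆ S) Xs →
  (A : Arcs n) → ∀ {u v} → ¬ (u ∈ S × v ∈ S) → invertAll Xs A u v ≡ A u v
invertAll-outside Xs Xs⊆S A {u} {v} uv∉S =
  trans (invertAll-parity Xs A u v)
        (cong (if_then A v u else A u v) (parity-outside Xs Xs⊆S uv∉S))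

restrict : Graph n → Arcs n → Arcs n
restrict K A u v = E K u v ∧ A u v

invertAll-restrict : (K : Graph n) (Xs : List (Subset n)) (A : Arcs n) → ∀ u v →
  invertAll Xs (restrict K A) u v ≡ restrict K (invertAll Xs A) u v
invertAll-restrict K Xs A u v
  rewrite invertAll-parity Xs (restrict K A) u v | invertAll-parity Xs A u v | sym K v u
  with parity Xs u v
... | true  = refl
... | false = refl

IsOrientation-invertAll : (G : Graph n) (Xs : List (Subset n)) (A : Arcs n) →
  IsOrientation G A → IsOrientation G (invertAll Xs A)
IsOrientation-invertAll G Xs A (antisym , no-arc) = antisym′ , no-arc′
  where
  not-swap : ∀ {x y} → x ≡ not y → y ≡ not x
  not-swap {x} {y} eq = trans (≡-sym (not-involutive y)) (cong not (≡-sym eq))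

  antisym′ : ∀ u v → E G u v ≡ true → invertAll Xs A u v ≡ not (invertAll Xs A v u)
  antisym′ u v uv∈E
    rewrite invertAll-parity Xs A u v | invertAll-parity Xs A v u | parity-sym Xs v u
    with parity Xs u v
  ... | true  = not-swap (antisym u v uv∈E)
  ... | false = antisym u v uv∈E

  no-arc′ : ∀ u v → E G u v ≡ false → invertAll Xs A u v ≡ false
  no-arc′ u v uv∉E rewrite invertAll-parity Xs A u v with parity Xs u v
  ... | true  = no-arc v u (trans (sym G v u) uv∉E)
  ... | false = no-arc u v uv∉E

restrict-IsOrientation : (G K : Graph n) →
  (∀ u v → E K u v ≡ true → E G u v ≡ true) →
  (A : Arcs n) → IsOrientation G A → IsOrientation K (restrict K A)
restrict-IsOrientation G K EK⊆EG A (antisym , _) = antisym′ , no-arc′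
  where
  antisym′ : ∀ u v → E K u v ≡ true → restrict K A u v ≡ not (restrict K A v u)
  antisym′ u v uv∈K rewrite uv∈K | trans (sym K v u) uv∈K = antisym u v (EK⊆EG u v uv∈K)

  no-arc′ : ∀ u v → E K u v ≡ false → restrict K A u v ≡ false
  no-arc′ u v uv∉K rewrite uv∉K = refl

IsOrientation-ext : (G : Graph n) (A B : Arcs n) → IsOrientation G A → IsOrientation G B →
  (∀ u v → E G u v ≡ true → A u v ≡ B u v) → ∀ u v → A u v ≡ B u v
IsOrientation-ext G A B (_ , A-no-arc) (_ , B-no-arc) agree u v with E G u v in uv∈?
... | true  = agree u v uv∈?
... | false = trans (A-no-arc u v uv∈?) (≡-sym (B-no-arc u v uv∈?))

agree-on-edges : (K : Graph n) (Xs : List (Subset n)) (A B : Arcs n) →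
  (∀ u v → invertAll Xs (restrict K A) u v ≡ restrict K B u v) →
  ∀ u v → E K u v ≡ true → invertAll Xs A u v ≡ B u v
agree-on-edges K Xs A B Xs-ok u v uv∈K = begin
  invertAll Xs A u v                  ≡⟨ cong (_∧ invertAll Xs A u v) (≡-sym uv∈K) ⟩
  restrict K (invertAll Xs A) u v     ≡⟨ ≡-sym (invertAll-restrict K Xs A u v) ⟩
  invertAll Xs (restrict K A) u v     ≡⟨ Xs-ok u v ⟩
  restrict K B u v                    ≡⟨ cong (_∧ B u v) uv∈K ⟩
  B u v                               ∎
  where open ≡-Reasoning

IsSmallInv-mono : ∀ {p} (H G : Graph n) {X : Subset n} →
  V H ⊆ V G → IsSmallInv p H X → IsSmallInv p G X
IsSmallInv-mono H G VH⊆VG (X⊆VH , |X|≤p) = (λ x∈X → VH⊆VG (X⊆VH x∈X)) , |X|≤p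

InducedSubgraph⇒edge⊆ : (I G : Graph n) → InducedSubgraph I G →
  ∀ u v → E I u v ≡ true → E G u v ≡ true
InducedSubgraph⇒edge⊆ I G (_ , induced) u v uv∈I =
  trans (≡-sym (induced u v (inV I u v uv∈I) (inV I v u (trans (sym I v u) uv∈I)))) uv∈I

InducedSubgraph⇒non-edge-outside : (I G : Graph n) → InducedSubgraph I G →
  ∀ {u v} → E G u v ≡ true → E I u v ≡ false → ¬ (u ∈ V I × v ∈ V I)
InducedSubgraph⇒non-edge-outside I G (_ , induced) {u} {v} uv∈G uv∉I (u∈I , v∈I)
  with trans (≡-sym uv∉I) (trans (induced u v u∈I v∈I) uv∈G)
... | ()

invertAll-agrees-on-union : (G H I : Graph n) → InducedSubgraph I G → IsUnion G H I →
  (Ys : List (Subset n)) → All (_⊆ V I) Ys → (B C : Arcs n) →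
  (∀ u v → E H u v ≡ true → B u v ≡ C u v) →
  (∀ u v → E I u v ≡ true → invertAll Ys B u v ≡ C u v) →
  ∀ u v → E G u v ≡ true → invertAll Ys B u v ≡ C u v
invertAll-agrees-on-union G H I I-induced (_ , EG⊆EH∪EI) Ys Ys⊆VI B C B-ok-on-H Ys-ok-on-I u v uv∈G
  with E I u v in uv∈I?
... | true  = Ys-ok-on-I u v uv∈I?
... | false = trans (invertAll-outside Ys Ys⊆VI B uv∉VI²) (B-ok-on-H u v uv∈H)
  where
  uv∉VI² : ¬ (u ∈ V I × v ∈ V I)
  uv∉VI² = InducedSubgraph⇒non-edge-outside I G I-induced uv∈G uv∈I?
  uv∈H : E H u v ≡ true
  uv∈H = trans (≡-sym (∨-identityʳ (E H u v)))
               (subst (λ b → E H u v ∨ b ≡ true) uv∈I? (EG⊆EH∪EI u v uv∈G))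

proposition6 : (p : ℕ) → 2 ≤ p → (n : ℕ) → (G H I : Graph n) →
    Subgraph H G → InducedSubgraph I G → IsUnion G H I →
    (a b : ℕ) → IdLe p H a → IdLe p I b → IdLe p G (a + b)
proposition6 p _ n G H I (VH⊆VG , EH⊆EG) I-induced@(VI⊆VG , _) G=H∪I a b idH idI A₁ A₂ o₁ o₂
  with idH (restrict H A₁) (restrict H A₂)
           (restrict-IsOrientation G H EH⊆EG A₁ o₁) (restrict-IsOrientation G H EH⊆EG A₂ o₂)
... | Xs , Xs-small , |Xs|≤a , Xs-ok
  with idI (restrict I (invertAll Xs A₁)) (restrict I A₂)
           (restrict-IsOrientation G I (InducedSubgraph⇒edge⊆ I G I-induced) _ (IsOrientation-invertAll G Xs A₁ o₁))
           (restrict-IsOrientation G I (InducedSubgraph⇒edge⊆ I G I-induced) A₂ o₂)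
... | Ys , Ys-small , |Ys|≤b , Ys-ok =
  Xs ++ Ys ,
  ++⁺ (All.map (IsSmallInv-mono H G VH⊆VG) Xs-small) (All.map (IsSmallInv-mono I G VI⊆VG) Ys-small) ,
  ≤-trans (≤-reflexive (length-++ Xs)) (+-mono-≤ |Xs|≤a |Ys|≤b) ,
  λ u v → trans (cong (λ A → A u v) (invertAll-++ Xs Ys A₁)) (final-ok u v)
  where
  final-ok : ∀ u v → invertAll Ys (invertAll Xs A₁) u v ≡ A₂ u v
  final-ok = IsOrientation-ext G _ A₂
    (IsOrientation-invertAll G Ys _ (IsOrientation-invertAll G Xs A₁ o₁)) o₂
    (invertAll-agrees-on-union G H I I-induced G=H∪I Ys (All.map proj₁ Ys-small) _ A₂
      (agree-on-edges H Xs A₁ A₂ Xs-ok) (agree-on-edges I Ys _ A₂ Ys-ok))
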